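{- Suppose $\gcd(m,n) = 1$, $m \geq 3$ is odd and $n \geq 3$ is odd. Then $\mathsf{DL}^{\circ}(L_{m,n}) = \frac{m+n}{2} - 1$.
   Context: $L_{m,n}$ is the $m\times n$ grid graph, i.e. the Cartesian product of a path on $m$ vertices and a path on $n$ vertices. For a finite connected graph $G=(V,E)$ with $|V|=N$ and graph distance $d$, a $k$-circular-dispersed labelling is a bijection $\phi:\mathbb{Z}_N\to V$ with $d(\phi(i),\phi(i+1))\ge k$ for all $i\in\mathbb{Z}_N$; $\mathsf{DL}^\circ(G)$ is the maximum such $k$. -}

module Defs where

open import Data.Nat using (ℕ; zero; suc; _+_; _*_; _≤_)
open import Data.Fin using (Fin; toℕ)
open import Data.Product using (_×_; Σ)
open import Data.Sum using (_⊎_)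
open import Relation.Binary.PropositionalEquality using (_≡_)
open import Function.Bundles using (_⤖_; Bijection)

record Graph : Set₁ where
  field
    Vertex : Set
    Adj    : Vertex → Vertex → Set

open Graph public

data Walk (G : Graph) : Vertex G → Vertex G → ℕ → Set where
  nil  : ∀ {u} → Walk G u u 0
  cons : ∀ {u w v l} → Adj G u w → Walk G w v l → Walk G u v (suc l)

-- d(u,v) ≥ k  (graph distance = length of a shortest walk):
-- every walk from u to v has length at least k.
DistAtLeast : (G : Graph) → ℕ → Vertex G → Vertex G → Set
DistAtLeast G k u v = ∀ l → Walk G u v l → k ≤ l

CycSucc : (N : ℕ) → Fin N → Fin N → Set
CycSucc N i j = (suc (toℕ i) ≡ toℕ j) ⊎ ((suc (toℕ i) ≡ N) × (toℕ j ≡ 0))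

IsCircDispersed : (G : Graph) (N : ℕ) (k : ℕ) → (Fin N ⤖ Vertex G) → Set
IsCircDispersed G N k φ =
  ∀ (i j : Fin N) → CycSucc N i j → DistAtLeast G k (Bijection.to φ i) (Bijection.to φ j)

HasCircDispersed : (G : Graph) (N : ℕ) (k : ℕ) → Set
HasCircDispersed G N k = Σ (Fin N ⤖ Vertex G) (IsCircDispersed G N k)

-- DL°(G) = d, where |V| = N: d is the maximum k admitting a
-- k-circular-dispersed labelling.
CircDL≡ : (G : Graph) (N : ℕ) (d : ℕ) → Set
CircDL≡ G N d = HasCircDispersed G N d × (∀ k → HasCircDispersed G N k → k ≤ d)

PathAdj : (n : ℕ) → Fin n → Fin n → Set
PathAdj n a b = (suc (toℕ a) ≡ toℕ b) ⊎ (suc (toℕ b) ≡ toℕ a)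

Grid : ℕ → ℕ → Graph
Grid m n = record
  { Vertex = Fin m × Fin n
  ; Adj    = λ u v →
      (Data.Product.proj₁ u ≡ Data.Product.proj₁ v × PathAdj n (Data.Product.proj₂ u) (Data.Product.proj₂ v))
      ⊎ (PathAdj m (Data.Product.proj₁ u) (Data.Product.proj₁ v) × Data.Product.proj₂ u ≡ Data.Product.proj₂ v)
  }

-- Write m = 2p + 1 and n = 2q + 1 and label i ∈ ℤ_{mn} by (p i mod m , q i mod n).  As p is a
-- unit modulo m, q a unit modulo n and gcd (m , n) = 1, this is a bijection (Chinese remainder
-- theorem).  Since m and n divide mn, every cyclic step i ↦ i + 1, including mn − 1 ↦ 0, adds
-- p in ℤ_m and q in ℤ_n, which moves the coordinates by at least p and q; so consecutive labels
-- are at Manhattan (= grid) distance at least p + q.  Conversely the centre (p , q) is within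
-- distance p + q of every vertex, so the label following the centre bounds every admissible k
-- by p + q = ⌊(m + n)/2⌋ − 1.
module Submission where

open import Defs
open import Data.Nat using (ℕ; _+_; _*_; _∸_; _≤_; ⌊_/2⌋)
open import Data.Nat.GCD using (gcd)
open import Data.Nat.Divisibility using (_∣_)
open import Relation.Nullary using (¬_)
open import Relation.Binary.PropositionalEquality using (_≡_)

open import Data.Empty using (⊥-elim)
open import Data.Fin as Fin using (Fin; toℕ; fromℕ<; punchOut; combine)
open import Data.Fin.Properties
  using (toℕ-injective; toℕ-fromℕ<; toℕ<n; any?; pigeonhole; punchOut-injective; combine-injective)
  renaming (<⇒≢ to <⇒≢ᶠ)
open import Data.Nat using (zero; suc; _<_; s≤s; s≤s⁻¹; NonZero; ∣_-_∣; _<?_)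
open import Data.Nat.Coprimality using (Coprime; gcd≡1⇒coprime; coprime⇒gcd≡1; coprime-divisor)
open import Data.Nat.Divisibility
  using (divides; ∣-refl; ∣1⇒≡1; ∣m∣n⇒∣m+n; ∣m+n∣m⇒∣n; ∣n⇒∣m*n; m∣m*n; n∣m*n; ∣⇒≤; n∣m⇒m%n≡0)
open import Data.Nat.DivMod
  using (_%_; _/_; m%n<n; m≡m%n+[m/n]*n; %-distribˡ-+; m%n%n≡m%n; m<n⇒m%n≡m; [m+n]%n≡m%n)
open import Data.Nat.LCM using (lcm; lcm-least; gcd*lcm)
open import Data.Nat.Properties
open import Algebra.Properties.CommutativeSemigroup +-commutativeSemigroup using (interchange)
open import Data.Product using (∃-syntax; _×_; _,_; proj₁; proj₂; uncurry)
open import Data.Sum as Sum using (inj₁; inj₂)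
open import Function using (_∘_)
open import Function.Bundles using (_⤖_; Bijection; mk⤖)
open import Relation.Nullary using (yes; no)
open import Relation.Binary.PropositionalEquality
  using (refl; sym; trans; cong; cong₂; subst; module ≡-Reasoning)

¬2∣⇒≡1+p+p : ∀ m → ¬ (2 ∣ m) → ∃[ p ] m ≡ suc (p + p)
¬2∣⇒≡1+p+p zero ¬2∣m = ⊥-elim (¬2∣m (divides 0 refl))
¬2∣⇒≡1+p+p (suc zero) _ = 0 , refl
¬2∣⇒≡1+p+p (suc (suc m)) ¬2∣m with ¬2∣⇒≡1+p+p m (¬2∣m ∘ ∣m∣n⇒∣m+n ∣-refl)
... | p , refl = suc p , cong (suc ∘ suc) (sym (+-suc p p))

⌊1+p+p+1+q+q/2⌋∸1≡p+q : ∀ p q → ⌊ suc (p + p) + suc (q + q) /2⌋ ∸ 1 ≡ p + q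
⌊1+p+p+1+q+q/2⌋∸1≡p+q p q = begin
  ⌊ suc (p + p) + suc (q + q) /2⌋ ∸ 1     ≡⟨ cong (λ x → ⌊ suc x /2⌋ ∸ 1) (+-suc (p + p) (q + q)) ⟩
  ⌊ suc (suc (p + p + (q + q))) /2⌋ ∸ 1   ≡⟨ cong (λ x → ⌊ suc (suc x) /2⌋ ∸ 1) (interchange p p q q) ⟩
  ⌊ (p + q) + (p + q) /2⌋                 ≡⟨ n≡⌊n+n/2⌋ (p + q) ⟨
  p + q                                   ∎
  where open ≡-Reasoning

coprime[1+p+p,p] : ∀ p → Coprime (suc (p + p)) p
coprime[1+p+p,p] p {d} (d∣1+p+p , d∣p) =
  ∣1⇒≡1 (∣m+n∣m⇒∣n (subst (d ∣_) (+-comm 1 (p + p)) d∣1+p+p) (∣m∣n⇒∣m+n d∣p d∣p))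

coprime⇒*∣ : ∀ {a b k} → Coprime a b → a ∣ k → b ∣ k → a * b ∣ k
coprime⇒*∣ {a} {b} coprime a∣k b∣k = subst (_∣ _) lcm≡a*b (lcm-least a∣k b∣k)
  where
  lcm≡a*b : lcm a b ≡ a * b
  lcm≡a*b = trans (sym (*-identityˡ (lcm a b)))
                  (trans (cong (_* lcm a b) (sym (coprime⇒gcd≡1 coprime))) (gcd*lcm a b))

∣∧<⇒≡0 : ∀ {d x} → d ∣ x → x < d → x ≡ 0
∣∧<⇒≡0 {x = zero}  _   _   = refl
∣∧<⇒≡0 {x = suc x} d∣x x<d = ⊥-elim (<⇒≱ x<d (∣⇒≤ d∣x))

%≡%⇒∣∸ : ∀ x y d .{{_ : NonZero d}} → x % d ≡ y % d → d ∣ y ∸ x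
%≡%⇒∣∸ x y d x%d≡y%d = divides (y / d ∸ x / d) (begin
  y ∸ x                                         ≡⟨ cong₂ _∸_ (m≡m%n+[m/n]*n y d) (m≡m%n+[m/n]*n x d) ⟩
  (y % d + (y / d) * d) ∸ (x % d + (x / d) * d) ≡⟨ cong (λ r → (r + (y / d) * d) ∸ (x % d + (x / d) * d))
                                                        (sym x%d≡y%d) ⟩
  (x % d + (y / d) * d) ∸ (x % d + (x / d) * d) ≡⟨ [m+n]∸[m+o]≡n∸o (x % d) _ _ ⟩
  (y / d) * d ∸ (x / d) * d                     ≡⟨ *-distribʳ-∸ d (y / d) (x / d) ⟨
  (y / d ∸ x / d) * d                           ∎)
  where open ≡-Reasoning

[m%d+n]%d≡[m+n]%d : ∀ m n d .{{_ : NonZero d}} → (m % d + n) % d ≡ (m + n) % d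
[m%d+n]%d≡[m+n]%d m n d = begin
  (m % d + n) % d           ≡⟨ %-distribˡ-+ (m % d) n d ⟩
  (m % d % d + n % d) % d   ≡⟨ cong (λ r → (r + n % d) % d) (m%n%n≡m%n m d) ⟩
  (m % d + n % d) % d       ≡⟨ %-distribˡ-+ m n d ⟨
  (m + n) % d               ∎
  where open ≡-Reasoning

∣n-1+n∣≡1 : ∀ n → ∣ n - suc n ∣ ≡ 1
∣n-1+n∣≡1 zero    = refl
∣n-1+n∣≡1 (suc n) = ∣n-1+n∣≡1 n

a≤p+p⇒∣p-a∣≤p : ∀ {p a} → a ≤ p + p → ∣ p - a ∣ ≤ p
a≤p+p⇒∣p-a∣≤p {p} {a} a≤p+p with ∣m-n∣≡[m∸n]∨[n∸m] p a
... | inj₁ eq = subst (_≤ p) (sym eq) (m∸n≤m p a)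
... | inj₂ eq = subst (_≤ p) (sym eq) (≤-trans (∸-monoˡ-≤ p a≤p+p) (≤-reflexive (m+n∸n≡m p p)))

p≤∣a-[a+p]%[1+p+p]∣ : ∀ p {a} → a < suc (p + p) → p ≤ ∣ a - (a + p) % suc (p + p) ∣
p≤∣a-[a+p]%[1+p+p]∣ p {a} a<M with a + p <? suc (p + p)
... | yes a+p<M = ≤-reflexive (sym (trans (cong (∣ a -_∣) (m<n⇒m%n≡m a+p<M)) (∣m-m+n∣≡n a p)))
... | no a+p≮M with m≤n⇒∃[o]m+o≡n (+-cancelʳ-≤ p (suc p) a (≮⇒≥ a+p≮M))
... | c , refl =
  subst (λ r → p ≤ ∣ suc p + c - r ∣) (sym wraps) (≤-trans (n≤1+n p) (≤-reflexive (sym gap)))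
  where
  wraps : (suc p + c + p) % suc (p + p) ≡ c
  wraps = begin
    (suc p + c + p) % suc (p + p)   ≡⟨ cong (_% suc (p + p)) rearrange ⟩
    (c + suc (p + p)) % suc (p + p) ≡⟨ [m+n]%n≡m%n c (suc (p + p)) ⟩
    c % suc (p + p)                 ≡⟨ m<n⇒m%n≡m (≤-<-trans (m≤n+m c (suc p)) a<M) ⟩
    c                               ∎
    where
    open ≡-Reasoning
    rearrange : suc p + c + p ≡ c + suc (p + p)
    rearrange = trans (cong suc (trans (+-assoc p c p)
                                       (trans (cong (p +_) (+-comm c p)) (sym (+-assoc p p c)))))
                      (+-comm (suc (p + p)) c)
  gap : ∣ suc p + c - c ∣ ≡ suc p
  gap = trans (∣-∣-comm (suc p + c) c) (trans (cong (∣ c -_∣) (+-comm (suc p) c)) (∣m-m+n∣≡n c (suc p)))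

Fin-injective⇒surjective : ∀ {n} (f : Fin n → Fin n) → (∀ {i j} → f i ≡ f j → i ≡ j) →
                           ∀ y → ∃[ x ] f x ≡ y
Fin-injective⇒surjective {suc n} f f-inj y with any? (λ x → f x Fin.≟ y)
... | yes hit = hit
... | no miss with pigeonhole (n<1+n n) (λ x → punchOut {i = y} {j = f x} (λ eq → miss (x , sym eq)))
... | i , j , i<j , eq =
  ⊥-elim (<⇒≢ᶠ i<j (f-inj (punchOut-injective (λ e → miss (i , sym e)) (λ e → miss (j , sym e)) eq)))

injective⇒bijection : ∀ {m n} (f : Fin (m * n) → Fin m × Fin n) → (∀ {i j} → f i ≡ f j → i ≡ j) →
                      Fin (m * n) ⤖ (Fin m × Fin n)
injective⇒bijection f f-inj = mk⤖ (f-inj , surjective)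
  where
  combine∘f-injective : ∀ {i j} → uncurry combine (f i) ≡ uncurry combine (f j) → i ≡ j
  combine∘f-injective eq = f-inj (uncurry (cong₂ _,_) (combine-injective _ _ _ _ eq))
  surjective : ∀ y → ∃[ x ] (∀ {z} → z ≡ x → f z ≡ y)
  surjective (a , b) with Fin-injective⇒surjective _ combine∘f-injective (combine a b)
  ... | x , eq with combine-injective _ _ a b eq
  ...   | refl , refl = x , λ { refl → refl }

_++ʷ_ : ∀ {G u v w l l′} → Walk G u v l → Walk G v w l′ → Walk G u w (l + l′)
nil      ++ʷ q = q
cons a p ++ʷ q = cons a (p ++ʷ q)

mapWalk : ∀ {G H} (f : Vertex G → Vertex H) → (∀ {u v} → Adj G u v → Adj H (f u) (f v)) →
          ∀ {u v l} → Walk G u v l → Walk H (f u) (f v) l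
mapWalk f f-adj nil        = nil
mapWalk f f-adj (cons a p) = cons (f-adj a) (mapWalk f f-adj p)

reverseWalk : ∀ {G} → (∀ {u v} → Adj G u v → Adj G v u) → ∀ {u v l} → Walk G u v l → Walk G v u l
reverseWalk adj-sym nil                = nil
reverseWalk adj-sym (cons {l = l} a p) =
  subst (Walk _ _ _) (+-comm l 1) (reverseWalk adj-sym p ++ʷ cons (adj-sym a) nil)

Path : ℕ → Graph
Path n = record { Vertex = Fin n ; Adj = PathAdj n }

ascendingWalk : ∀ {n} d (a b : Fin n) → toℕ a + d ≡ toℕ b → Walk (Path n) a b d
ascendingWalk zero a b a+0≡b with toℕ-injective (trans (sym (+-identityʳ (toℕ a))) a+0≡b)
... | refl = nil
ascendingWalk {n} (suc d) a b a+1+d≡b =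
  cons (inj₁ (sym (toℕ-fromℕ< 1+a<n)))
       (ascendingWalk d (fromℕ< 1+a<n) b (trans (cong (_+ d) (toℕ-fromℕ< 1+a<n)) a+1+d≡b′))
  where
  a+1+d≡b′ : suc (toℕ a + d) ≡ toℕ b
  a+1+d≡b′ = trans (sym (+-suc (toℕ a) d)) a+1+d≡b
  1+a<n : suc (toℕ a) < n
  1+a<n = ≤-<-trans (subst (suc (toℕ a) ≤_) a+1+d≡b′ (s≤s (m≤m+n (toℕ a) d))) (toℕ<n b)

pathWalk : ∀ {n} (a b : Fin n) → Walk (Path n) a b ∣ toℕ a - toℕ b ∣
pathWalk a b with ≤-total (toℕ a) (toℕ b)
... | inj₁ a≤b = subst (Walk _ a b) (sym (m≤n⇒∣m-n∣≡n∸m a≤b)) (ascendingWalk _ a b (m+[n∸m]≡n a≤b))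
... | inj₂ b≤a = subst (Walk _ a b) (sym (m≤n⇒∣n-m∣≡n∸m b≤a))
                       (reverseWalk Sum.swap (ascendingWalk _ b a (m+[n∸m]≡n b≤a)))

PathAdj⇒∣-∣≡1 : ∀ {n} {a b : Fin n} → PathAdj n a b → ∣ toℕ a - toℕ b ∣ ≡ 1
PathAdj⇒∣-∣≡1 {a = a} (inj₁ 1+a≡b) rewrite sym 1+a≡b = ∣n-1+n∣≡1 (toℕ a)
PathAdj⇒∣-∣≡1 {b = b} (inj₂ 1+b≡a) rewrite sym 1+b≡a =
  trans (∣-∣-comm (suc (toℕ b)) (toℕ b)) (∣n-1+n∣≡1 (toℕ b))

manhattan : ∀ {m n} → Fin m × Fin n → Fin m × Fin n → ℕ
manhattan (a , b) (c , d) = ∣ toℕ a - toℕ c ∣ + ∣ toℕ b - toℕ d ∣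

manhattan-self : ∀ {m n} (u : Fin m × Fin n) → manhattan u u ≡ 0
manhattan-self (a , b) = cong₂ _+_ (∣n-n∣≡0 (toℕ a)) (∣n-n∣≡0 (toℕ b))

manhattan-triangle : ∀ {m n} (u v w : Fin m × Fin n) → manhattan u w ≤ manhattan u v + manhattan v w
manhattan-triangle (a , b) (c , d) (e , f) =
  ≤-trans (+-mono-≤ (∣-∣-triangle (toℕ a) (toℕ c) (toℕ e)) (∣-∣-triangle (toℕ b) (toℕ d) (toℕ f)))
          (≤-reflexive (interchange ∣ toℕ a - toℕ c ∣ ∣ toℕ c - toℕ e ∣ ∣ toℕ b - toℕ d ∣ ∣ toℕ d - toℕ f ∣))

Adj⇒manhattan≡1 : ∀ {m n} {u v : Fin m × Fin n} → Adj (Grid m n) u v → manhattan u v ≡ 1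
Adj⇒manhattan≡1 {u = a , _} {_ , _} (inj₁ (refl , b~d)) = cong₂ _+_ (∣n-n∣≡0 (toℕ a)) (PathAdj⇒∣-∣≡1 b~d)
Adj⇒manhattan≡1 {u = _ , b} {_ , _} (inj₂ (a~c , refl)) =
  trans (cong₂ _+_ (PathAdj⇒∣-∣≡1 a~c) (∣n-n∣≡0 (toℕ b))) (+-identityʳ 1)

manhattan≤length : ∀ {m n} {u v : Fin m × Fin n} {l} → Walk (Grid m n) u v l → manhattan u v ≤ l
manhattan≤length {u = u} nil = ≤-reflexive (manhattan-self u)
manhattan≤length {u = u} {v} {suc l} (cons {w = w} u~w p) = begin
  manhattan u v                  ≤⟨ manhattan-triangle u w v ⟩
  manhattan u w + manhattan w v  ≡⟨ cong (_+ manhattan w v) (Adj⇒manhattan≡1 u~w) ⟩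
  suc (manhattan w v)            ≤⟨ s≤s (manhattan≤length p) ⟩
  suc l                          ∎
  where open ≤-Reasoning

manhattanWalk : ∀ {m n} (u v : Fin m × Fin n) → Walk (Grid m n) u v (manhattan u v)
manhattanWalk (a , b) (c , d) =
  mapWalk (_, b) (λ a~c → inj₂ (a~c , refl)) (pathWalk a c) ++ʷ
  mapWalk (c ,_) (λ b~d → inj₁ (refl , b~d)) (pathWalk b d)

cycSucc-exists : ∀ {K} (i : Fin (suc K)) → ∃[ j ] CycSucc (suc K) i j
cycSucc-exists {K} i with suc (toℕ i) <? suc K
... | yes 1+i<N = fromℕ< 1+i<N , inj₁ (sym (toℕ-fromℕ< 1+i<N))
... | no  1+i≮N = Fin.zero , inj₂ (≤-antisym (toℕ<n i) (≮⇒≥ 1+i≮N) , refl)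

dispersion≤eccentricity : ∀ {G K k e} (c : Vertex G) → (∀ v → ∃[ l ] l ≤ e × Walk G c v l) →
                          HasCircDispersed G (suc K) k → k ≤ e
dispersion≤eccentricity {G} c reach (φ , dispersed) with Bijection.surjective φ c
... | i , φi≡c with cycSucc-exists i
... | j , i→j with reach (Bijection.to φ j)
... | l , l≤e , walk =
  ≤-trans (dispersed i j i→j l (subst (λ u → Walk G u _ l) (sym (φi≡c refl)) walk)) l≤e

cycSucc⇒%-step : ∀ p {M K} .{{_ : NonZero M}} → M ∣ K → {i j : Fin K} → CycSucc K i j →
                 (p * toℕ j) % M ≡ ((p * toℕ i) % M + p) % M
cycSucc⇒%-step p {M} {K} M∣K {i} {j} i→j = trans (step i→j) (sym ([m%d+n]%d≡[m+n]%d (p * toℕ i) p M))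
  where
  shift : p * suc (toℕ i) ≡ p * toℕ i + p
  shift = trans (*-suc p (toℕ i)) (+-comm p (p * toℕ i))
  step : CycSucc K i j → (p * toℕ j) % M ≡ (p * toℕ i + p) % M
  step (inj₁ 1+i≡j) = cong (_% M) (trans (cong (p *_) (sym 1+i≡j)) shift)
  step (inj₂ (1+i≡K , j≡0)) = trans (n∣m⇒m%n≡0 _ M M∣p*j) (sym (n∣m⇒m%n≡0 _ M M∣p*i+p))
    where
    M∣p*j : M ∣ p * toℕ j
    M∣p*j = subst (λ x → M ∣ p * x) (sym j≡0) (subst (M ∣_) (sym (*-zeroʳ p)) (divides 0 refl))
    M∣p*i+p : M ∣ p * toℕ i + p
    M∣p*i+p = subst (M ∣_) shift (subst (λ x → M ∣ p * x) (sym 1+i≡K) (∣n⇒∣m*n p M∣K))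

cycSucc⇒p≤∣p*i%M-p*j%M∣ : ∀ p {K} → suc (p + p) ∣ K → {i j : Fin K} → CycSucc K i j →
                          p ≤ ∣ (p * toℕ i) % suc (p + p) - (p * toℕ j) % suc (p + p) ∣
cycSucc⇒p≤∣p*i%M-p*j%M∣ p M∣K {i} i→j = subst (λ r → p ≤ ∣ (p * toℕ i) % suc (p + p) - r ∣)
  (sym (cycSucc⇒%-step p M∣K i→j)) (p≤∣a-[a+p]%[1+p+p]∣ p (m%n<n (p * toℕ i) (suc (p + p))))

module Labelling {M N : ℕ} .{{_ : NonZero M}} .{{_ : NonZero N}} (p q : ℕ) where

  label : ∀ {K} → Fin K → Fin M × Fin N
  label i = fromℕ< (m%n<n (p * toℕ i) M) , fromℕ< (m%n<n (q * toℕ i) N)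

  toℕ-label₁ : ∀ {K} (i : Fin K) → toℕ (proj₁ (label i)) ≡ (p * toℕ i) % M
  toℕ-label₁ i = toℕ-fromℕ< (m%n<n (p * toℕ i) M)

  toℕ-label₂ : ∀ {K} (i : Fin K) → toℕ (proj₂ (label i)) ≡ (q * toℕ i) % N
  toℕ-label₂ i = toℕ-fromℕ< (m%n<n (q * toℕ i) N)

  manhattan-label : ∀ {K} (i j : Fin K) → manhattan (label i) (label j) ≡
                    ∣ (p * toℕ i) % M - (p * toℕ j) % M ∣ + ∣ (q * toℕ i) % N - (q * toℕ j) % N ∣
  manhattan-label i j =
    cong₂ _+_ (cong₂ ∣_-_∣ (toℕ-label₁ i) (toℕ-label₁ j)) (cong₂ ∣_-_∣ (toℕ-label₂ i) (toℕ-label₂ j))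

  label-residues : ∀ {K} {i j : Fin K} → label i ≡ label j →
                   (p * toℕ i) % M ≡ (p * toℕ j) % M × (q * toℕ i) % N ≡ (q * toℕ j) % N
  label-residues {i = i} {j} eq =
    trans (sym (toℕ-label₁ i)) (trans (cong (toℕ ∘ proj₁) eq) (toℕ-label₁ j)) ,
    trans (sym (toℕ-label₂ i)) (trans (cong (toℕ ∘ proj₂) eq) (toℕ-label₂ j))

  module _ (M⊥p : Coprime M p) (N⊥q : Coprime N q) (M⊥N : Coprime M N) where

    residues≡⇒≡ : ∀ {x y} → x ≤ y → y < M * N →
                  (p * x) % M ≡ (p * y) % M → (q * x) % N ≡ (q * y) % N → x ≡ y
    residues≡⇒≡ {x} {y} x≤y y<MN px≡py qx≡qy = ≤-antisym x≤y (m∸n≡0⇒m≤n y∸x≡0)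
      where
      M∣y∸x : M ∣ y ∸ x
      M∣y∸x = coprime-divisor M⊥p
                (subst (M ∣_) (sym (*-distribˡ-∸ p y x)) (%≡%⇒∣∸ (p * x) (p * y) M px≡py))
      N∣y∸x : N ∣ y ∸ x
      N∣y∸x = coprime-divisor N⊥q
                (subst (N ∣_) (sym (*-distribˡ-∸ q y x)) (%≡%⇒∣∸ (q * x) (q * y) N qx≡qy))
      y∸x≡0 : y ∸ x ≡ 0
      y∸x≡0 = ∣∧<⇒≡0 (coprime⇒*∣ M⊥N M∣y∸x N∣y∸x) (≤-<-trans (m∸n≤m y x) y<MN)

    label-injective : ∀ {i j : Fin (M * N)} → label i ≡ label j → i ≡ j
    label-injective {i} {j} eq with label-residues eq | ≤-total (toℕ i) (toℕ j)
    ... | p≡ , q≡ | inj₁ i≤j = toℕ-injective (residues≡⇒≡ i≤j (toℕ<n j) p≡ q≡)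
    ... | p≡ , q≡ | inj₂ j≤i = toℕ-injective (sym (residues≡⇒≡ j≤i (toℕ<n i) (sym p≡) (sym q≡)))

middle : ∀ p → Fin (suc (p + p))
middle p = fromℕ< (s≤s (m≤m+n p p))

∣middle-a∣≤p : ∀ p (a : Fin (suc (p + p))) → ∣ toℕ (middle p) - toℕ a ∣ ≤ p
∣middle-a∣≤p p a =
  subst (λ x → ∣ x - toℕ a ∣ ≤ p) (sym (toℕ-fromℕ< (s≤s (m≤m+n p p)))) (a≤p+p⇒∣p-a∣≤p (s≤s⁻¹ (toℕ<n a)))

DL°-oddGrid : ∀ p q → Coprime (suc (p + p)) (suc (q + q)) →
              CircDL≡ (Grid (suc (p + p)) (suc (q + q))) (suc (p + p) * suc (q + q)) (p + q)
DL°-oddGrid p q M⊥N =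
  (φ , dispersed) , λ k → dispersion≤eccentricity (middle p , middle q) eccentricity
  where
  open Labelling {suc (p + p)} {suc (q + q)} p q
  φ : Fin (suc (p + p) * suc (q + q)) ⤖ (Fin (suc (p + p)) × Fin (suc (q + q)))
  φ = injective⇒bijection label (label-injective (coprime[1+p+p,p] p) (coprime[1+p+p,p] q) M⊥N)
  dispersed : IsCircDispersed (Grid (suc (p + p)) (suc (q + q))) (suc (p + p) * suc (q + q)) (p + q) φ
  dispersed i j i→j l walk =
    ≤-trans (subst (p + q ≤_) (sym (manhattan-label i j)) steps) (manhattan≤length walk)
    where
    steps : p + q ≤ ∣ (p * toℕ i) % suc (p + p) - (p * toℕ j) % suc (p + p) ∣
                    + ∣ (q * toℕ i) % suc (q + q) - (q * toℕ j) % suc (q + q) ∣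
    steps = +-mono-≤ (cycSucc⇒p≤∣p*i%M-p*j%M∣ p (m∣m*n (suc (q + q))) i→j)
                     (cycSucc⇒p≤∣p*i%M-p*j%M∣ q (n∣m*n (suc (p + p))) i→j)
  eccentricity : ∀ v → ∃[ l ] l ≤ p + q × Walk (Grid (suc (p + p)) (suc (q + q))) (middle p , middle q) v l
  eccentricity (a , b) =
    _ , +-mono-≤ (∣middle-a∣≤p p a) (∣middle-a∣≤p q b) , manhattanWalk (middle p , middle q) (a , b)

corollary3p5 : (m n : ℕ) → gcd m n ≡ 1 → 3 ≤ m → ¬ (2 ∣ m) → 3 ≤ n → ¬ (2 ∣ n) →
    CircDL≡ (Grid m n) (m * n) (⌊ (m + n) /2⌋ ∸ 1)
corollary3p5 m n gcd≡1 _ ¬2∣m _ ¬2∣n with ¬2∣⇒≡1+p+p m ¬2∣m | ¬2∣⇒≡1+p+p n ¬2∣n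
... | p , refl | q , refl rewrite ⌊1+p+p+1+q+q/2⌋∸1≡p+q p q = DL°-oddGrid p q (gcd≡1⇒coprime gcd≡1)
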